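{- Let $F$ be an unsatisfiable hitting clause-set and $v\in\mathrm{var}(F)$ with $\mathrm{ldeg}_F(v)=\mathrm{ldeg}_F(\overline v)=2$. Then $F$ is fs-resolvable, or $F$ admits an nfs-flip whose result is fs-resolvable.
   Context: Variables are positive integers, literals are nonzero integers, the complement of $x$ is $\overline{x}=-x$, $\mathrm{var}(x)=|x|$. A clause is a finite set of literals with no pair $x,\overline{x}$; a clause-set is a finite set of clauses; $\mathrm{var}(F)$ is the set of variables occurring in $F$. $F$ is satisfiable if some clause meets every clause of $F$, otherwise unsatisfiable. $F$ is hitting if any two distinct clauses $C,D\in F$ have some $x\in C$ with $\overline{x}\in D$. $\mathrm{ldeg}_F(x)$ is the number of clauses of $F$ containing $x$. An fs-pair is $\{E\cup\{w\},E\cup\{\overline w\}\}$ with $E$ a clause and $w,\overline w\notin E$; $F$ is fs-resolvable if it contains an fs-pair $\{E\cup\{w\},E\cup\{\overline w\}\}$ with $E\notin F$. An nfs-pair is $\{E\cup\{x\},E\cup\{\overline{x},y\}\}$ with $E$ a clause, $\mathrm{var}(x)\ne\mathrm{var}(y)$, $x,\overline x,y,\overline y\notin E$; its nfs-flip is $\{E\cup\{x,\overline y\},E\cup\{y\}\}$. An nfs-flip on $F$ replaces an nfs-pair $P\subseteq F$, neither of whose flip clauses lies in $F$, by its nfs-flip. -}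

module Defs where

open import Data.Integer using (ℤ; -_; +_; _<_; 0ℤ)
open import Data.Integer.Properties using (_≟_)
open import Data.List using (List; []; _∷_; filter; length)
open import Data.List.Membership.Propositional using (_∈_; _∉_)
open import Data.List.Membership.DecPropositional _≟_ using (_∈?_)
open import Data.List.Relation.Binary.Subset.Propositional using (_⊆_)
open import Data.List.Relation.Binary.Subset.DecPropositional _≟_ using (_⊆?_)
open import Data.List.Relation.Unary.All using (All)
open import Data.List.Relation.Unary.Any using (Any)
open import Data.List.Relation.Unary.AllPairs using (AllPairs)
open import Data.Nat using (ℕ)
open import Data.Product using (_×_; ∃; ∃-syntax; Σ-syntax)
open import Data.Sum using (_⊎_)
open import Relation.Binary.PropositionalEquality using (_≡_)
open import Relation.Nullary using (¬_; Dec; yes; no)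
open import Relation.Nullary.Decidable using (_×-dec_; ¬?)

-- Literals are nonzero integers; complement is negation; var(x) = |x|.
Lit : Set
Lit = ℤ

-- A clause is represented by a list of literals, read as the finite set
-- of its elements (order and repetitions are irrelevant).
Clause : Set
Clause = List Lit

_≈_ : Clause → Clause → Set
C ≈ D = C ⊆ D × D ⊆ C

_≈?_ : (C D : Clause) → Dec (C ≈ D)
C ≈? D = (C ⊆? D) ×-dec (D ⊆? C)

IsClause : Clause → Set
IsClause C = All (λ x → ¬ x ≡ 0ℤ) C × (∀ x → x ∈ C → - x ∉ C)

-- A clause-set is represented by a list of clauses, read as the finite set
-- of its entries; well-formed: every entry a clause, no two entries equal
-- as sets (so entries correspond bijectively to the clauses of the set).
ClauseSet : Set
ClauseSet = List Clause

IsClauseSet : ClauseSet → Set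
IsClauseSet F = All IsClause F × AllPairs (λ C D → ¬ C ≈ D) F

_∈ᶜ_ : Clause → ClauseSet → Set
C ∈ᶜ F = Any (λ D → C ≈ D) F

_∉ᶜ_ : Clause → ClauseSet → Set
C ∉ᶜ F = ¬ (C ∈ᶜ F)

InVar : ℤ → ClauseSet → Set
InVar v F = Any (λ C → v ∈ C ⊎ - v ∈ C) F

Satisfiable : ClauseSet → Set
Satisfiable F = ∃[ C ] (IsClause C × All (λ D → ∃[ x ] (x ∈ C × x ∈ D)) F)

Clash : Clause → Clause → Set
Clash C D = ∃[ x ] (x ∈ C × - x ∈ D)

Hitting : ClauseSet → Set
Hitting F = AllPairs Clash F

ldeg : ClauseSet → Lit → ℕ
ldeg F x = length (filter (λ C → x ∈? C) F)

FsResolvable : ClauseSet → Set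
FsResolvable F =
  ∃[ E ] ∃[ w ] (IsClause E × ¬ w ≡ 0ℤ × w ∉ E × - w ∉ E
    × (w ∷ E) ∈ᶜ F × (- w ∷ E) ∈ᶜ F × E ∉ᶜ F)

IsNfsPair : Clause → Lit → Lit → Set
IsNfsPair E x y =
  IsClause E × ¬ x ≡ 0ℤ × ¬ y ≡ 0ℤ × ¬ x ≡ y × ¬ x ≡ - y
  × x ∉ E × - x ∉ E × y ∉ E × - y ∉ E

flipResult : ClauseSet → Clause → Lit → Lit → ClauseSet
flipResult F E x y =
  (x ∷ - y ∷ E) ∷ (y ∷ E) ∷
  filter (λ C → ¬? (C ≈? (x ∷ E)) ×-dec ¬? (C ≈? (- x ∷ y ∷ E))) F

NfsFlipToFsResolvable : ClauseSet → Set
NfsFlipToFsResolvable F =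
  ∃[ E ] ∃[ x ] ∃[ y ] (IsNfsPair E x y
    × (x ∷ E) ∈ᶜ F × (- x ∷ y ∷ E) ∈ᶜ F
    × (x ∷ - y ∷ E) ∉ᶜ F × (y ∷ E) ∉ᶜ F
    × FsResolvable (flipResult F E x y))

-- Let A₁, A₂ be the clauses containing v, B₁, B₂ those containing v̄, and P_i = A_i ∖ {v},
-- Q_i = B_i ∖ {v̄} their residues. If a ∈ Q₁ and b ∈ Q₂ lie outside P₁ and are not complementary,
-- then {a, b, v} ∪ ¬P₁ would satisfy F (every clause avoiding v and v̄ clashes with A₁); the same
-- holds for all symmetric variants. These constraints leave three cases: if some residue of v
-- is contained in one of v̄ (or conversely), then either P_i = Q_j, and A_i, B_j form an fs-pair
-- on v, or {Q₁, Q₂} is the nfs-flip of {P₁, P₂}, and flipping {A₁, A₂} creates {v} ∪ Q₁, an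
-- fs-partner of B₁; if no such inclusion holds, P₁ and P₂ form an fs-pair, hence so do A₁, A₂.

module Submission where

open import Defs
open import Data.Integer using (ℤ; -_; _<_; 0ℤ; +_; -[1+_])
open import Data.Integer.Properties using (_≟_; neg-involutive; neg-injective)
open import Data.Nat using (zero; suc)
open import Data.List using (List; []; _∷_; filter; map; length; _++_)
open import Data.List.Membership.Propositional using (_∈_; _∉_; find; lose)
open import Data.List.Membership.DecPropositional _≟_ using (_∈?_)
open import Data.List.Membership.Propositional.Properties
  using (∈-filter⁺; ∈-filter⁻; ∈-map⁺; ∈-map⁻; ∈-++⁺ˡ; ∈-++⁺ʳ; ∈-++⁻)
open import Data.List.Relation.Binary.Subset.Propositional using (_⊆_)
open import Data.List.Relation.Unary.Any using (here; there)
open import Data.List.Relation.Unary.All as All using (All; []; _∷_)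
open import Data.List.Relation.Unary.All.Properties using (¬All⇒Any¬) renaming (map⁺ to All-map⁺)
open import Data.List.Relation.Unary.AllPairs using (AllPairs; []; _∷_)
import Data.List.Relation.Unary.AllPairs.Properties as AllPairs
open import Data.Product using (∃-syntax; _×_; _,_; proj₁; proj₂)
open import Data.Sum using (_⊎_; inj₁; inj₂; [_,_]; swap)
open import Data.Empty using (⊥-elim)
open import Relation.Binary.PropositionalEquality
  using (_≡_; _≢_; refl; sym; trans; cong; subst)
open import Function using (id)
open import Relation.Nullary using (¬_; yes; no)
open import Relation.Nullary.Decidable using (¬?)

variable
  a b c l : Lit
  L X Y Z : Clause
  F : ClauseSet

neg-swap : a ≡ - b → b ≡ - a
neg-swap {a} {b} a≡-b = trans (sym (neg-involutive b)) (cong -_ (sym a≡-b))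

-l≡l⇒l≡0 : - l ≡ l → l ≡ 0ℤ
-l≡l⇒l≡0 {+ zero}    _ = refl
-l≡l⇒l≡0 {+ suc n}   ()
-l≡l⇒l≡0 { -[1+ n ]} ()

Consistent : Clause → Set
Consistent C = ∀ x → x ∈ C → - x ∉ C

∉-∷ : a ≢ l → a ∉ X → a ∉ l ∷ X
∉-∷ a≢l a∉X (here a≡l) = a≢l a≡l
∉-∷ a≢l a∉X (there a∈X) = a∉X a∈X

isClause-∷ : l ≢ 0ℤ → - l ∉ X → IsClause X → IsClause (l ∷ X)
isClause-∷ {l} {X} l≢0 -l∉X (nonzero , consistent) = l≢0 ∷ nonzero , consistent′
  where
  consistent′ : Consistent (l ∷ X)
  consistent′ _ (here refl) (here -l≡l) = l≢0 (-l≡l⇒l≡0 -l≡l)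
  consistent′ _ (here refl) (there -l∈X) = -l∉X -l∈X
  consistent′ x (there x∈X) (here -x≡l) = -l∉X (subst (_∈ X) (neg-swap (sym -x≡l)) x∈X)
  consistent′ x (there x∈X) (there -x∈X) = consistent x x∈X -x∈X

isClause-map-neg : IsClause X → IsClause (map -_ X)
isClause-map-neg {X} (nonzero , consistent) =
  All-map⁺ (All.map (λ x≢0 -x≡0 → x≢0 (neg-injective -x≡0)) nonzero) , consistent′
  where
  consistent′ : Consistent (map -_ X)
  consistent′ x x∈ -x∈ with ∈-map⁻ -_ x∈ | ∈-map⁻ -_ -x∈
  ... | y , y∈X , x≡-y | y′ , y′∈X , -x≡-y′ =
    consistent y y∈X (subst (_∈ X) (trans (sym (neg-injective -x≡-y′)) x≡-y) y′∈X)

∈-map-neg : - l ∈ X → l ∈ map -_ X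
∈-map-neg {l} {X} -l∈X = subst (_∈ map -_ X) (neg-involutive l) (∈-map⁺ -_ -l∈X)

isClause-⊆ : X ⊆ Y → IsClause Y → IsClause X
isClause-⊆ X⊆Y (nonzero , consistent) =
  All.tabulate (λ x∈X → All.lookup nonzero (X⊆Y x∈X)) ,
  λ x x∈X -x∈X → consistent x (X⊆Y x∈X) (X⊆Y -x∈X)

clash-sym : Clash X Y → Clash Y X
clash-sym {X} (x , x∈X , -x∈Y) = - x , -x∈Y , subst (_∈ X) (sym (neg-involutive x)) x∈X

infixl 25 _∖_

_∖_ : Clause → Lit → Clause
X ∖ l = filter (λ x → ¬? (x ≟ l)) X

∈-∖⁺ : a ∈ X → a ≢ l → a ∈ X ∖ l
∈-∖⁺ {l = l} = ∈-filter⁺ (λ x → ¬? (x ≟ l))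

∈-∖⁻ : a ∈ X ∖ l → a ∈ X × a ≢ l
∈-∖⁻ {l = l} = ∈-filter⁻ (λ x → ¬? (x ≟ l))

∉-∖ : ∀ X → l ∉ X ∖ l
∉-∖ X l∈ = proj₂ (∈-∖⁻ {X = X} l∈) refl

consistent-∖ : Consistent X → Consistent (X ∖ l)
consistent-∖ cX x x∈ -x∈ = cX x (proj₁ (∈-∖⁻ x∈)) (proj₁ (∈-∖⁻ -x∈))

≈-refl : X ≈ X
≈-refl = id , id

≈-sym : X ≈ Y → Y ≈ X
≈-sym (X⊆Y , Y⊆X) = Y⊆X , X⊆Y

≈-∷-∖ : a ∈ X → X ≈ (a ∷ X ∖ a)
≈-∷-∖ {a} {X} a∈X = to , from
  where
  to : X ⊆ a ∷ X ∖ a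
  to {l} l∈X with l ≟ a
  ... | yes l≡a = here l≡a
  ... | no l≢a = there (∈-∖⁺ l∈X l≢a)
  from : a ∷ X ∖ a ⊆ X
  from (here refl) = a∈X
  from (there l∈) = proj₁ (∈-∖⁻ l∈)

≈-reinsert : ∀ {E} L → l ∈ X → X ∖ l ≈ (L ++ E) → X ≈ (L ++ l ∷ E)
≈-reinsert {l} {X} {E} L l∈X (to , from) = to′ , from′
  where
  to′ : X ⊆ L ++ l ∷ E
  to′ {x} x∈X with x ≟ l
  ... | yes x≡l = ∈-++⁺ʳ L (here x≡l)
  ... | no x≢l with ∈-++⁻ L (to (∈-∖⁺ x∈X x≢l))
  ...   | inj₁ x∈L = ∈-++⁺ˡ x∈L
  ...   | inj₂ x∈E = ∈-++⁺ʳ L (there x∈E)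
  from′ : L ++ l ∷ E ⊆ X
  from′ x∈ with ∈-++⁻ L x∈
  ... | inj₁ x∈L = proj₁ (∈-∖⁻ (from (∈-++⁺ˡ x∈L)))
  ... | inj₂ (here refl) = l∈X
  ... | inj₂ (there x∈E) = proj₁ (∈-∖⁻ (from (∈-++⁺ʳ L x∈E)))

≈-rotate : (a ∷ b ∷ c ∷ L) ≈ (b ∷ c ∷ a ∷ L)
≈-rotate =
  (λ { (here e) → there (there (here e)) ; (there (here e)) → here e
     ; (there (there (here e))) → there (here e) ; (there (there (there i))) → there (there (there i)) }) ,
  (λ { (here e) → there (here e) ; (there (here e)) → there (there (here e))
     ; (there (there (here e))) → here e ; (there (there (there i))) → there (there (there i)) })

Outside : Clause → Clause → Set
Outside X Y = ∃[ l ] (l ∈ X × l ∉ Y)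

⊆-or-outside : (X Y : Clause) → X ⊆ Y ⊎ Outside X Y
⊆-or-outside X Y with All.all? (_∈? Y) X
... | yes X⊆Y = inj₁ (All.lookup X⊆Y)
... | no X⊈Y = inj₂ (find (¬All⇒Any¬ (_∈? Y) X X⊈Y))

⊆-∷-by-exception : (∀ {x} → x ∈ X → x ∉ Y → x ≡ a) → X ⊆ a ∷ Y
⊆-∷-by-exception {Y = Y} exception {x} x∈X with x ∈? Y
... | yes x∈Y = there x∈Y
... | no x∉Y = here (exception x∈X x∉Y)

⊆-∷-absorb : a ∈ Y → X ⊆ a ∷ Y → X ⊆ Y
⊆-∷-absorb a∈Y X⊆a∷Y x∈X with X⊆a∷Y x∈X
... | here refl = a∈Y
... | there x∈Y = x∈Y

lookup-pair : ∀ {A : Set} {R : A → A → Set} {xs x y} →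
              AllPairs R xs → x ∈ xs → y ∈ xs → x ≢ y → R x y ⊎ R y x
lookup-pair (r ∷ rs) (here refl) (here refl) x≢y = ⊥-elim (x≢y refl)
lookup-pair (r ∷ rs) (here refl) (there y∈) _   = inj₁ (All.lookup r y∈)
lookup-pair (r ∷ rs) (there x∈) (here refl) _   = inj₂ (All.lookup r x∈)
lookup-pair (r ∷ rs) (there x∈) (there y∈) x≢y = lookup-pair rs x∈ y∈ x≢y

length≡2 : ∀ {A : Set} (xs : List A) → length xs ≡ 2 → ∃[ x ] ∃[ y ] xs ≡ x ∷ y ∷ []
length≡2 (x ∷ y ∷ []) refl = x , y , refl

OutsideComplementary : Clause → Clause → Clause → Set
OutsideComplementary X Y Z = ∀ {a b} → a ∈ Y → b ∈ Z → a ∉ X → b ∉ X → a ≡ - b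

outsideComplementary-sym : OutsideComplementary X Y Z → OutsideComplementary X Z Y
outsideComplementary-sym oc a∈Z b∈Y a∉X b∉X = neg-swap (oc b∈Y a∈Z b∉X a∉X)

record ResidueConditions (P₁ P₂ Q₁ Q₂ : Clause) : Set where
  field
    consistent-P₁ : Consistent P₁
    consistent-P₂ : Consistent P₂
    consistent-Q₁ : Consistent Q₁
    consistent-Q₂ : Consistent Q₂
    clash-P : Clash P₁ P₂
    clash-Q : Clash Q₁ Q₂
    outside-P₁ : OutsideComplementary P₁ Q₁ Q₂
    outside-P₂ : OutsideComplementary P₂ Q₁ Q₂
    outside-Q₁ : OutsideComplementary Q₁ P₁ P₂
    outside-Q₂ : OutsideComplementary Q₂ P₁ P₂

swap-P : ∀ {P₁ P₂ Q₁ Q₂} → ResidueConditions P₁ P₂ Q₁ Q₂ → ResidueConditions P₂ P₁ Q₁ Q₂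
swap-P rc = record
  { consistent-P₁ = consistent-P₂ ; consistent-P₂ = consistent-P₁
  ; consistent-Q₁ = consistent-Q₁ ; consistent-Q₂ = consistent-Q₂
  ; clash-P = clash-sym clash-P ; clash-Q = clash-Q
  ; outside-P₁ = outside-P₂ ; outside-P₂ = outside-P₁
  ; outside-Q₁ = outsideComplementary-sym outside-Q₁
  ; outside-Q₂ = outsideComplementary-sym outside-Q₂ }
  where open ResidueConditions rc

record FsPair (X Y : Clause) : Set where
  constructor fsPair
  field
    w : Lit
    E : Clause
    X≈w∷E : X ≈ (w ∷ E)
    Y≈-w∷E : Y ≈ (- w ∷ E)
    w∉E : w ∉ E
    -w∉E : - w ∉ E

record NfsFlipped (P₁ P₂ Q₁ Q₂ : Clause) : Set where
  constructor nfsFlipped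
  field
    x y : Lit
    E : Clause
    P₁≈ : P₁ ≈ (x ∷ E)
    P₂≈ : P₂ ≈ (- x ∷ y ∷ E)
    Q₁≈ : Q₁ ≈ (x ∷ - y ∷ E)
    Q₂≈ : Q₂ ≈ (y ∷ E)
    x≢y : x ≢ y
    x≢-y : x ≢ - y
    x∉E : x ∉ E
    -x∉E : - x ∉ E
    y∉E : y ∉ E
    -y∉E : - y ∉ E

module ResiduesIncluded {P₁ P₂ Q₁ Q₂ : Clause}
  (rc : ResidueConditions P₁ P₂ Q₁ Q₂) (P₁⊆Q₁ : P₁ ⊆ Q₁) where
  open ResidueConditions rc

  x : Lit
  x = proj₁ clash-P
  x∈P₁ : x ∈ P₁
  x∈P₁ = proj₁ (proj₂ clash-P)
  -x∈P₂ : - x ∈ P₂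
  -x∈P₂ = proj₂ (proj₂ clash-P)
  z : Lit
  z = proj₁ clash-Q
  z∈Q₁ : z ∈ Q₁
  z∈Q₁ = proj₁ (proj₂ clash-Q)
  -z∈Q₂ : - z ∈ Q₂
  -z∈Q₂ = proj₂ (proj₂ clash-Q)

  -z∉P₁ : - z ∉ P₁
  -z∉P₁ -z∈P₁ = consistent-Q₁ z z∈Q₁ (P₁⊆Q₁ -z∈P₁)

  x∉P₂ : x ∉ P₂
  x∉P₂ x∈P₂ = consistent-P₂ x x∈P₂ -x∈P₂

  Q₁⊆z∷P₁ : Q₁ ⊆ z ∷ P₁
  Q₁⊆z∷P₁ = ⊆-∷-by-exception λ l∈Q₁ l∉P₁ →
    trans (outside-P₁ l∈Q₁ -z∈Q₂ l∉P₁ -z∉P₁) (neg-involutive z)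

  Q₂⊆P₂ : Q₂ ⊆ P₂
  Q₂⊆P₂ = ⊆-∷-absorb -x∈P₂ (⊆-∷-by-exception λ l∈Q₂ l∉P₂ →
    neg-swap (outside-P₂ (P₁⊆Q₁ x∈P₁) l∈Q₂ x∉P₂ l∉P₂))

  x∉Q₂ : x ∉ Q₂
  x∉Q₂ x∈Q₂ = x∉P₂ (Q₂⊆P₂ x∈Q₂)

  P₂⊆-x∷Q₂ : P₂ ⊆ - x ∷ Q₂
  P₂⊆-x∷Q₂ = ⊆-∷-by-exception λ l∈P₂ l∉Q₂ → neg-swap (outside-Q₂ x∈P₁ l∈P₂ x∉Q₂ l∉Q₂)

  module Flipped (z∉P₁ : z ∉ P₁) (-x∉Q₂ : - x ∉ Q₂) where
    E : Clause
    E = Q₂ ∖ (- z)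

    Q₂⊆-z∷P₁ : Q₂ ⊆ - z ∷ P₁
    Q₂⊆-z∷P₁ = ⊆-∷-by-exception λ l∈Q₂ l∉P₁ → neg-swap (outside-P₁ z∈Q₁ l∈Q₂ z∉P₁ l∉P₁)

    P₁⊆x∷Q₂ : P₁ ⊆ x ∷ Q₂
    P₁⊆x∷Q₂ = ⊆-∷-by-exception λ l∈P₁ l∉Q₂ →
      trans (outside-Q₂ l∈P₁ -x∈P₂ l∉Q₂ -x∉Q₂) (neg-involutive x)

    E⊆P₁ : E ⊆ P₁
    E⊆P₁ l∈E with ∈-∖⁻ l∈E
    ... | l∈Q₂ , l≢-z with Q₂⊆-z∷P₁ l∈Q₂
    ...   | here l≡-z = ⊥-elim (l≢-z l≡-z)
    ...   | there l∈P₁ = l∈P₁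

    P₁≈ : P₁ ≈ (x ∷ E)
    P₁≈ = to , from
      where
      to : P₁ ⊆ x ∷ E
      to l∈P₁ with P₁⊆x∷Q₂ l∈P₁
      ... | here l≡x = here l≡x
      ... | there l∈Q₂ = there (∈-∖⁺ l∈Q₂ λ { refl → -z∉P₁ l∈P₁ })
      from : x ∷ E ⊆ P₁
      from (here refl) = x∈P₁
      from (there l∈E) = E⊆P₁ l∈E

    P₂≈ : P₂ ≈ (- x ∷ - z ∷ E)
    P₂≈ = to , from
      where
      to : P₂ ⊆ - x ∷ - z ∷ E
      to {l} l∈P₂ with P₂⊆-x∷Q₂ l∈P₂
      ... | here l≡-x = here l≡-x
      ... | there l∈Q₂ with l ≟ - z
      ...   | yes l≡-z = there (here l≡-z)
      ...   | no l≢-z = there (there (∈-∖⁺ l∈Q₂ l≢-z))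
      from : - x ∷ - z ∷ E ⊆ P₂
      from (here refl) = -x∈P₂
      from (there (here refl)) = Q₂⊆P₂ -z∈Q₂
      from (there (there l∈E)) = Q₂⊆P₂ (proj₁ (∈-∖⁻ l∈E))

    Q₁≈ : Q₁ ≈ (x ∷ - - z ∷ E)
    Q₁≈ = to , from
      where
      to : Q₁ ⊆ x ∷ - - z ∷ E
      to l∈Q₁ with Q₁⊆z∷P₁ l∈Q₁
      ... | here l≡z = there (here (trans l≡z (sym (neg-involutive z))))
      ... | there l∈P₁ with proj₁ P₁≈ l∈P₁
      ...   | here l≡x = here l≡x
      ...   | there l∈E = there (there l∈E)
      from : x ∷ - - z ∷ E ⊆ Q₁
      from (here refl) = P₁⊆Q₁ x∈P₁
      from (there (here refl)) = subst (_∈ Q₁) (sym (neg-involutive z)) z∈Q₁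
      from (there (there l∈E)) = P₁⊆Q₁ (E⊆P₁ l∈E)

    flipped : NfsFlipped P₁ P₂ Q₁ Q₂
    flipped = nfsFlipped x (- z) E P₁≈ P₂≈ Q₁≈ (≈-∷-∖ -z∈Q₂)
      (λ { refl → -z∉P₁ x∈P₁ })
      (λ x≡-[-z] → z∉P₁ (subst (_∈ P₁) (trans x≡-[-z] (neg-involutive z)) x∈P₁))
      (λ x∈E → x∉Q₂ (proj₁ (∈-∖⁻ x∈E)))
      (λ -x∈E → -x∉Q₂ (proj₁ (∈-∖⁻ -x∈E)))
      (∉-∖ Q₂)
      (λ negneg-z∈E → consistent-Q₂ (- z) -z∈Q₂ (proj₁ (∈-∖⁻ {X = Q₂} negneg-z∈E)))

  residues-⊆ : P₁ ≈ Q₁ ⊎ P₂ ≈ Q₂ ⊎ NfsFlipped P₁ P₂ Q₁ Q₂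
  residues-⊆ with z ∈? P₁ | - x ∈? Q₂
  ... | yes z∈P₁ | _ = inj₁ (P₁⊆Q₁ , ⊆-∷-absorb z∈P₁ Q₁⊆z∷P₁)
  ... | no _ | yes -x∈Q₂ = inj₂ (inj₁ (⊆-∷-absorb -x∈Q₂ P₂⊆-x∷Q₂ , Q₂⊆P₂))
  ... | no z∉P₁ | no -x∉Q₂ = inj₂ (inj₂ (Flipped.flipped z∉P₁ -x∉Q₂))

open ResiduesIncluded using (residues-⊆)

⊆-∷-other-residue : ∀ {P₁ P₂ Q₁ Q₂} → ResidueConditions P₁ P₂ Q₁ Q₂ → Outside Q₁ P₁ → Outside Q₂ P₂ →
                    a ∈ P₁ → a ∉ Q₁ → b ∈ P₂ → b ∉ Q₁ → P₁ ⊆ a ∷ P₂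
⊆-∷-other-residue {P₁ = P₁} {P₂} {Q₁} {Q₂} rc (z , z∈Q₁ , z∉P₁) (c , c∈Q₂ , c∉P₂) a∈P₁ a∉Q₁ b∈P₂ b∉Q₁ =
  ⊆-∷-by-exception exception
  where
  open ResidueConditions rc
  exception : l ∈ P₁ → l ∉ P₂ → l ≡ _
  exception {l} l∈P₁ l∉P₂ with l ∈? Q₁
  ... | no l∉Q₁ = trans (outside-Q₁ l∈P₁ b∈P₂ l∉Q₁ b∉Q₁) (sym (outside-Q₁ a∈P₁ b∈P₂ a∉Q₁ b∉Q₁))
  ... | yes l∈Q₁ = ⊥-elim (z∉P₁ (subst (_∈ P₁) (sym z≡l) l∈P₁))
    where
    -l∈Q₂ : - l ∈ Q₂
    -l∈Q₂ = subst (_∈ Q₂) (neg-swap (outside-P₂ l∈Q₁ c∈Q₂ l∉P₂ c∉P₂)) c∈Q₂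
    z≡l : z ≡ l
    z≡l = trans (outside-P₁ z∈Q₁ -l∈Q₂ z∉P₁ (consistent-P₁ l l∈P₁)) (neg-involutive l)

residues-fsPair : ∀ {P₁ P₂ Q₁ Q₂} → ResidueConditions P₁ P₂ Q₁ Q₂ → Outside P₁ Q₁ → Outside P₂ Q₁ →
                  Outside Q₁ P₁ → Outside Q₂ P₁ → Outside Q₁ P₂ → Outside Q₂ P₂ → FsPair P₁ P₂
residues-fsPair {P₁ = P₁} {P₂} rc (a , a∈P₁ , a∉Q₁) (b , b∈P₂ , b∉Q₁) Q₁⊈P₁ Q₂⊈P₁ Q₁⊈P₂ Q₂⊈P₂ =
  fsPair a (P₁ ∖ a) (≈-∷-∖ a∈P₁) (to , from)
    (∉-∖ P₁)
    (λ -a∈E → consistent-P₁ a a∈P₁ (proj₁ (∈-∖⁻ {X = P₁} -a∈E)))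
  where
  open ResidueConditions rc
  b≡-a : b ≡ - a
  b≡-a = neg-swap (outside-Q₁ a∈P₁ b∈P₂ a∉Q₁ b∉Q₁)
  P₁⊆a∷P₂ : P₁ ⊆ a ∷ P₂
  P₁⊆a∷P₂ = ⊆-∷-other-residue rc Q₁⊈P₁ Q₂⊈P₂ a∈P₁ a∉Q₁ b∈P₂ b∉Q₁
  P₂⊆b∷P₁ : P₂ ⊆ b ∷ P₁
  P₂⊆b∷P₁ = ⊆-∷-other-residue (swap-P rc) Q₁⊈P₂ Q₂⊈P₁ b∈P₂ b∉Q₁ a∈P₁ a∉Q₁
  to : P₂ ⊆ - a ∷ P₁ ∖ a
  to {l} l∈P₂ with P₂⊆b∷P₁ l∈P₂
  ... | here l≡b = here (trans l≡b b≡-a)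
  ... | there l∈P₁ = there (∈-∖⁺ l∈P₁ λ { refl →
          consistent-P₂ l l∈P₂ (subst (_∈ P₂) b≡-a b∈P₂) })
  from : - a ∷ P₁ ∖ a ⊆ P₂
  from (here refl) = subst (_∈ P₂) b≡-a b∈P₂
  from (there l∈E) with ∈-∖⁻ l∈E
  ... | l∈P₁ , l≢a with P₁⊆a∷P₂ l∈P₁
  ...   | here l≡a = ⊥-elim (l≢a l≡a)
  ...   | there l∈P₂ = l∈P₂

record ExactlyTwo (F : ClauseSet) (l : Lit) : Set where
  field
    C₁ C₂ : Clause
    C₁∈F : C₁ ∈ F
    C₂∈F : C₂ ∈ F
    l∈C₁ : l ∈ C₁
    l∈C₂ : l ∈ C₂
    C₁≢C₂ : C₁ ≢ C₂
    only : ∀ {D} → D ∈ F → l ∈ D → D ≡ C₁ ⊎ D ≡ C₂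

exactlyTwo-swap : ExactlyTwo F l → ExactlyTwo F l
exactlyTwo-swap t = record
  { C₁ = C₂ ; C₂ = C₁ ; C₁∈F = C₂∈F ; C₂∈F = C₁∈F ; l∈C₁ = l∈C₂ ; l∈C₂ = l∈C₁
  ; C₁≢C₂ = λ C₂≡C₁ → C₁≢C₂ (sym C₂≡C₁) ; only = λ D∈F l∈D → swap (only D∈F l∈D) }
  where open ExactlyTwo t

exactlyTwo : IsClauseSet F → ldeg F l ≡ 2 → ExactlyTwo F l
exactlyTwo {F} {l} (_ , distinct) deg with length≡2 (filter (l ∈?_) F) deg
... | C₁ , C₂ , eq = record
  { C₁ = C₁ ; C₂ = C₂
  ; C₁∈F = proj₁ C₁∈F×l∈C₁ ; C₂∈F = proj₁ C₂∈F×l∈C₂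
  ; l∈C₁ = proj₂ C₁∈F×l∈C₁ ; l∈C₂ = proj₂ C₂∈F×l∈C₂
  ; C₁≢C₂ = C₁≢C₂ ; only = only }
  where
  C₁∈F×l∈C₁ : C₁ ∈ F × l ∈ C₁
  C₁∈F×l∈C₁ = ∈-filter⁻ (l ∈?_) (subst (C₁ ∈_) (sym eq) (here refl))
  C₂∈F×l∈C₂ : C₂ ∈ F × l ∈ C₂
  C₂∈F×l∈C₂ = ∈-filter⁻ (l ∈?_) (subst (C₂ ∈_) (sym eq) (there (here refl)))
  C₁≢C₂ : C₁ ≢ C₂
  C₁≢C₂ refl with subst (AllPairs _) eq (AllPairs.filter⁺ (l ∈?_) distinct)
  ... | (C₁≉C₁ ∷ []) ∷ _ = C₁≉C₁ ≈-refl
  only : ∀ {D} → D ∈ F → l ∈ D → D ≡ C₁ ⊎ D ≡ C₂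
  only D∈F l∈D with subst (_ ∈_) eq (∈-filter⁺ (l ∈?_) D∈F l∈D)
  ... | here D≡C₁ = inj₁ D≡C₁
  ... | there (here D≡C₂) = inj₂ D≡C₂

-- p̄ is the complement of p, recorded in both directions so that the roles of p and p̄ can be
-- exchanged without rewriting - - p to p.
record Occurrences (F : ClauseSet) : Set where
  field
    p p̄ : Lit
    p̄≡-p : p̄ ≡ - p
    p≡-p̄ : p ≡ - p̄
    occ-p : ExactlyTwo F p
    occ-p̄ : ExactlyTwo F p̄

swap-A : Occurrences F → Occurrences F
swap-A o = record o { occ-p = exactlyTwo-swap (Occurrences.occ-p o) }

swap-B : Occurrences F → Occurrences F
swap-B o = record o { occ-p̄ = exactlyTwo-swap (Occurrences.occ-p̄ o) }

mirror : Occurrences F → Occurrences F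
mirror o = record
  { p = p̄ ; p̄ = p ; p̄≡-p = p≡-p̄ ; p≡-p̄ = p̄≡-p ; occ-p = occ-p̄ ; occ-p̄ = occ-p }
  where open Occurrences o

module Residues {F : ClauseSet} (o : Occurrences F) where
  open Occurrences o public
  open ExactlyTwo occ-p public using () renaming
    (C₁ to A₁; C₂ to A₂; C₁∈F to A₁∈F; C₂∈F to A₂∈F; l∈C₁ to p∈A₁; l∈C₂ to p∈A₂;
     C₁≢C₂ to A₁≢A₂; only to p-only)
  open ExactlyTwo occ-p̄ public using () renaming
    (C₁ to B₁; C₂ to B₂; C₁∈F to B₁∈F; C₂∈F to B₂∈F; l∈C₁ to p̄∈B₁; l∈C₂ to p̄∈B₂;
     only to p̄-only)

  P₁ P₂ Q₁ Q₂ : Clause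
  P₁ = A₁ ∖ p
  P₂ = A₂ ∖ p
  Q₁ = B₁ ∖ p̄
  Q₂ = B₂ ∖ p̄

module _ {F : ClauseSet} (isClauseSet : IsClauseSet F) (hitting : Hitting F) where

  clause-∈ : X ∈ F → IsClause X
  clause-∈ = All.lookup (proj₁ isClauseSet)

  consistent-∈ : X ∈ F → Consistent X
  consistent-∈ X∈F = proj₂ (clause-∈ X∈F)

  nonzero-∈ : X ∈ F → l ∈ X → l ≢ 0ℤ
  nonzero-∈ X∈F = All.lookup (proj₁ (clause-∈ X∈F))

  clash-∈ : X ∈ F → Y ∈ F → X ≢ Y → Clash X Y
  clash-∈ X∈F Y∈F X≢Y = [ id , clash-sym ] (lookup-pair hitting X∈F Y∈F X≢Y)

  proper-subclause-∉ : X ∈ F → Y ⊆ X → l ∈ X → l ∉ Y → Y ∉ᶜ F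
  proper-subclause-∉ X∈F Y⊆X l∈X l∉Y Y∈ᶜF with find Y∈ᶜF
  ... | D , D∈F , (_ , D⊆Y) with clash-∈ D∈F X∈F (λ { refl → l∉Y (D⊆Y l∈X) })
  ...   | x , x∈D , -x∈X = consistent-∈ X∈F x (Y⊆X (D⊆Y x∈D)) -x∈X

  p∉B₁ : (o : Occurrences F) → let open Residues o in p ∉ B₁
  p∉B₁ o p∈B₁ = consistent-∈ B₁∈F p̄ p̄∈B₁ (subst (_∈ B₁) p≡-p̄ p∈B₁)
    where open Residues o

  residue-clash : (o : Occurrences F) → let open Residues o in Clash P₁ P₂
  residue-clash o with clash-∈ (Residues.A₁∈F o) (Residues.A₂∈F o) (Residues.A₁≢A₂ o)
  ... | x , x∈A₁ , -x∈A₂ = x , ∈-∖⁺ x∈A₁ x≢p , ∈-∖⁺ -x∈A₂ -x≢p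
    where
    open Residues o
    x≢p : x ≢ p
    x≢p refl = consistent-∈ A₂∈F p p∈A₂ -x∈A₂
    -x≢p : - x ≢ p
    -x≢p -x≡p = consistent-∈ A₁∈F p p∈A₁ (subst (_∈ A₁) (neg-swap (sym -x≡p)) x∈A₁)

  module Resolution (o : Occurrences F) where
    open Residues o

    p≢0 : p ≢ 0ℤ
    p≢0 = nonzero-∈ A₁∈F p∈A₁

    ∈P₁⇒∈A₁ : l ∈ P₁ → l ∈ A₁
    ∈P₁⇒∈A₁ l∈P₁ = proj₁ (∈-∖⁻ l∈P₁)

    ∈P₂⇒∈A₂ : l ∈ P₂ → l ∈ A₂
    ∈P₂⇒∈A₂ l∈P₂ = proj₁ (∈-∖⁻ l∈P₂)

    ∈P₁⇒≢p : l ∈ P₁ → l ≢ p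
    ∈P₁⇒≢p l∈P₁ = proj₂ (∈-∖⁻ {X = A₁} l∈P₁)

    ∈P₂⇒≢p : l ∈ P₂ → l ≢ p
    ∈P₂⇒≢p l∈P₂ = proj₂ (∈-∖⁻ {X = A₂} l∈P₂)

    p∷E⊆A₁ : ∀ {E} → l ∷ E ⊆ P₁ → p ∷ E ⊆ A₁
    p∷E⊆A₁ l∷E⊆P₁ (here refl) = p∈A₁
    p∷E⊆A₁ l∷E⊆P₁ (there x∈E) = ∈P₁⇒∈A₁ (l∷E⊆P₁ (there x∈E))

    fsResolvable-fsPair : FsPair P₁ P₂ → FsResolvable F
    fsResolvable-fsPair (fsPair w E P₁≈ P₂≈ w∉E -w∉E) =
      p ∷ E , w , isClause-⊆ (p∷E⊆A₁ (proj₂ P₁≈)) (clause-∈ A₁∈F) , nonzero-∈ A₁∈F w∈A₁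
      , w∉p∷E , ∉-∷ (∈P₂⇒≢p -w∈P₂) -w∉E
      , lose A₁∈F (≈-sym (≈-reinsert (w ∷ []) p∈A₁ P₁≈))
      , lose A₂∈F (≈-sym (≈-reinsert (- w ∷ []) p∈A₂ P₂≈))
      , proper-subclause-∉ A₁∈F (p∷E⊆A₁ (proj₂ P₁≈)) w∈A₁ w∉p∷E
      where
      w∈P₁ : w ∈ P₁
      w∈P₁ = proj₂ P₁≈ (here refl)
      w∈A₁ : w ∈ A₁
      w∈A₁ = ∈P₁⇒∈A₁ w∈P₁
      -w∈P₂ : - w ∈ P₂
      -w∈P₂ = proj₂ P₂≈ (here refl)
      w∉p∷E : w ∉ p ∷ E
      w∉p∷E = ∉-∷ (∈P₁⇒≢p w∈P₁) w∉E

    fsResolvable-≈ : P₁ ≈ Q₁ → FsResolvable F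
    fsResolvable-≈ P₁≈Q₁ =
      P₁ , p , isClause-⊆ ∈P₁⇒∈A₁ (clause-∈ A₁∈F) , p≢0 , ∉-∖ A₁
      , (λ -p∈P₁ → consistent-∈ A₁∈F p p∈A₁ (∈P₁⇒∈A₁ -p∈P₁))
      , lose A₁∈F (≈-sym (≈-∷-∖ p∈A₁))
      , lose B₁∈F (subst (λ p̄′ → (p̄′ ∷ P₁) ≈ B₁) p̄≡-p (≈-sym (≈-reinsert [] p̄∈B₁ (≈-sym P₁≈Q₁))))
      , proper-subclause-∉ A₁∈F ∈P₁⇒∈A₁ p∈A₁ (∉-∖ A₁)

    module Flip (flipped : NfsFlipped P₁ P₂ Q₁ Q₂) where
      open NfsFlipped flipped

      x∈P₁ : x ∈ P₁
      x∈P₁ = proj₂ P₁≈ (here refl)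
      -x∈P₂ : - x ∈ P₂
      -x∈P₂ = proj₂ P₂≈ (here refl)
      y∈P₂ : y ∈ P₂
      y∈P₂ = proj₂ P₂≈ (there (here refl))

      x∷-y∷E⊆B₁ : x ∷ - y ∷ E ⊆ B₁
      x∷-y∷E⊆B₁ l∈ = proj₁ (∈-∖⁻ (proj₂ Q₁≈ l∈))

      p̄∉x∷-y∷E : p̄ ∉ x ∷ - y ∷ E
      p̄∉x∷-y∷E p̄∈ = ∉-∖ B₁ (proj₂ Q₁≈ p̄∈)

      p∉x∷-y∷E : p ∉ x ∷ - y ∷ E
      p∉x∷-y∷E p∈ = p∉B₁ o (x∷-y∷E⊆B₁ p∈)

      -y≢p : - y ≢ p
      -y≢p -y≡p = p∉x∷-y∷E (there (here (sym -y≡p)))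

      nfsPair : IsNfsPair (p ∷ E) x y
      nfsPair =
        isClause-⊆ (p∷E⊆A₁ (proj₂ P₁≈)) (clause-∈ A₁∈F)
        , nonzero-∈ A₁∈F (∈P₁⇒∈A₁ x∈P₁) , nonzero-∈ A₂∈F (∈P₂⇒∈A₂ y∈P₂) , x≢y , x≢-y
        , ∉-∷ (∈P₁⇒≢p x∈P₁) x∉E , ∉-∷ (∈P₂⇒≢p -x∈P₂) -x∉E
        , ∉-∷ (∈P₂⇒≢p y∈P₂) y∉E , ∉-∷ -y≢p -y∉E

      flip₁∉F : (x ∷ - y ∷ p ∷ E) ∉ᶜ F
      flip₁∉F flip₁∈ᶜF with find flip₁∈ᶜF
      ... | D , D∈F , (flip₁⊆D , _) with p-only D∈F (flip₁⊆D (there (there (here refl))))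
      ...   | inj₂ refl = consistent-∈ A₂∈F x (flip₁⊆D (here refl)) (∈P₂⇒∈A₂ -x∈P₂)
      ...   | inj₁ refl with proj₁ P₁≈ (∈-∖⁺ (flip₁⊆D (there (here refl))) -y≢p)
      ...     | here -y≡x = x≢-y (sym -y≡x)
      ...     | there -y∈E = -y∉E -y∈E

      flip₂∉F : (y ∷ p ∷ E) ∉ᶜ F
      flip₂∉F = proper-subclause-∉ A₂∈F y∷p∷E⊆A₂ (∈P₂⇒∈A₂ -x∈P₂)
        (∉-∷ (λ -x≡y → x≢-y (neg-swap (sym -x≡y))) (∉-∷ (∈P₂⇒≢p -x∈P₂) -x∉E))
        where
        y∷p∷E⊆A₂ : y ∷ p ∷ E ⊆ A₂
        y∷p∷E⊆A₂ (here refl) = ∈P₂⇒∈A₂ y∈P₂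
        y∷p∷E⊆A₂ (there (here refl)) = p∈A₂
        y∷p∷E⊆A₂ (there (there l∈E)) = ∈P₂⇒∈A₂ (proj₂ P₂≈ (there (there l∈E)))

      flipped-fsResolvable : FsResolvable (flipResult F (p ∷ E) x y)
      flipped-fsResolvable =
        x ∷ - y ∷ E , p , isClause-⊆ x∷-y∷E⊆B₁ (clause-∈ B₁∈F) , p≢0
        , p∉x∷-y∷E , (λ -p∈ → p̄∉x∷-y∷E (subst (_∈ x ∷ - y ∷ E) (sym p̄≡-p) -p∈))
        , here ≈-rotate
        , there (there (lose (∈-filter⁺ _ B₁∈F (B₁≉flip {X = x ∷ []} , B₁≉flip {X = - x ∷ y ∷ []}))
            (subst (λ p̄′ → (p̄′ ∷ x ∷ - y ∷ E) ≈ B₁) p̄≡-p (≈-sym (≈-reinsert [] p̄∈B₁ Q₁≈)))))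
        , ∉flipResult
        where
        B₁≉flip : ∀ {X} → ¬ B₁ ≈ (X ++ p ∷ E)
        B₁≉flip {X} (_ , ⊆B₁) = p∉B₁ o (⊆B₁ (∈-++⁺ʳ X (here refl)))
        ∉flipResult : (x ∷ - y ∷ E) ∉ᶜ flipResult F (p ∷ E) x y
        ∉flipResult (here (_ , flip₁⊆)) = p∉x∷-y∷E (flip₁⊆ (there (there (here refl))))
        ∉flipResult (there (here (_ , flip₂⊆))) = p∉x∷-y∷E (flip₂⊆ (there (here refl)))
        ∉flipResult (there (there ∈filtered)) with find ∈filtered
        ... | D , D∈ , ≈D = proper-subclause-∉ B₁∈F x∷-y∷E⊆B₁ p̄∈B₁ p̄∉x∷-y∷E
                              (lose (proj₁ (∈-filter⁻ _ D∈)) ≈D)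

      nfsFlipToFsResolvable : NfsFlipToFsResolvable F
      nfsFlipToFsResolvable =
        p ∷ E , x , y , nfsPair
        , lose A₁∈F (≈-sym (≈-reinsert (x ∷ []) p∈A₁ P₁≈))
        , lose A₂∈F (≈-sym (≈-reinsert (- x ∷ y ∷ []) p∈A₂ P₂≈))
        , flip₁∉F , flip₂∉F , flipped-fsResolvable

  module _ (unsat : ¬ Satisfiable F) where

    -- The clause {a, b, p} ∪ ¬P₁ meets B₁, B₂ and the two clauses containing p directly, and every
    -- other clause D in the literal on which D clashes with A₁.
    outside-complementary : (o : Occurrences F) → let open Residues o in
                            OutsideComplementary P₁ Q₁ Q₂
    outside-complementary o {a} {b} a∈Q₁ b∈Q₂ a∉P₁ b∉P₁ with a ≟ - b
    ... | yes a≡-b = a≡-b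
    ... | no a≢-b = ⊥-elim (unsat (a ∷ b ∷ p ∷ map -_ P₁ , isClause-witness , All.tabulate meets))
      where
      open Residues o
      a∈B₁ : a ∈ B₁
      a∈B₁ = proj₁ (∈-∖⁻ a∈Q₁)
      b∈B₂ : b ∈ B₂
      b∈B₂ = proj₁ (∈-∖⁻ b∈Q₂)
      -l∉¬P₁ : l ∉ P₁ → - l ∉ map -_ P₁
      -l∉¬P₁ {l} l∉P₁ -l∈ with ∈-map⁻ -_ -l∈
      ... | y , y∈P₁ , -l≡-y = l∉P₁ (subst (_∈ P₁) (sym (neg-injective -l≡-y)) y∈P₁)
      -l≢p : ∀ {X l} → l ∈ X ∖ p̄ → - l ≢ p
      -l≢p {X} l∈ -l≡p = proj₂ (∈-∖⁻ {X = X} l∈) (trans (neg-swap (sym -l≡p)) (sym p̄≡-p))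
      isClause-witness : IsClause (a ∷ b ∷ p ∷ map -_ P₁)
      isClause-witness =
        isClause-∷ (nonzero-∈ B₁∈F a∈B₁)
          (∉-∷ (λ -a≡b → a≢-b (neg-swap (sym -a≡b))) (∉-∷ (-l≢p {B₁} a∈Q₁) (-l∉¬P₁ a∉P₁)))
        (isClause-∷ (nonzero-∈ B₂∈F b∈B₂) (∉-∷ (-l≢p {B₂} b∈Q₂) (-l∉¬P₁ b∉P₁))
        (isClause-∷ (nonzero-∈ A₁∈F p∈A₁) (-l∉¬P₁ (∉-∖ A₁))
        (isClause-map-neg (isClause-⊆ (λ l∈P₁ → proj₁ (∈-∖⁻ l∈P₁)) (clause-∈ A₁∈F)))))
      meets : ∀ {D} → D ∈ F → ∃[ x ] (x ∈ a ∷ b ∷ p ∷ map -_ P₁ × x ∈ D)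
      meets {D} D∈F with p ∈? D
      ... | yes p∈D = p , there (there (here refl)) , p∈D
      ... | no p∉D with p̄ ∈? D
      ...   | yes p̄∈D = [ (λ { refl → a , here refl , a∈B₁ }) , (λ { refl → b , there (here refl) , b∈B₂ }) ]
                          (p̄-only D∈F p̄∈D)
      ...   | no p̄∉D with clash-∈ D∈F A₁∈F (λ { refl → p∉D p∈A₁ })
      ...     | x , x∈D , -x∈A₁ = x , there (there (there (∈-map-neg (∈-∖⁺ -x∈A₁ -x≢p)))) , x∈D
        where
        -x≢p : - x ≢ p
        -x≢p -x≡p = p̄∉D (subst (_∈ D) (trans (neg-swap (sym -x≡p)) (sym p̄≡-p)) x∈D)

    residueConditions : (o : Occurrences F) → let open Residues o in ResidueConditions P₁ P₂ Q₁ Q₂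
    residueConditions o = record
      { consistent-P₁ = consistent-∖ (consistent-∈ A₁∈F)
      ; consistent-P₂ = consistent-∖ (consistent-∈ A₂∈F)
      ; consistent-Q₁ = consistent-∖ (consistent-∈ B₁∈F)
      ; consistent-Q₂ = consistent-∖ (consistent-∈ B₂∈F)
      ; clash-P = residue-clash o
      ; clash-Q = residue-clash (mirror o)
      ; outside-P₁ = outside-complementary o
      ; outside-P₂ = outside-complementary (swap-A o)
      ; outside-Q₁ = outside-complementary (mirror o)
      ; outside-Q₂ = outside-complementary (swap-A (mirror o)) }
      where open Residues o

    result-⊆ : (o : Occurrences F) → let open Residues o in
               P₁ ⊆ Q₁ → FsResolvable F ⊎ NfsFlipToFsResolvable F
    result-⊆ o P₁⊆Q₁ with residues-⊆ (residueConditions o) P₁⊆Q₁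
    ... | inj₁ P₁≈Q₁ = inj₁ (Resolution.fsResolvable-≈ o P₁≈Q₁)
    ... | inj₂ (inj₁ P₂≈Q₂) = inj₁ (Resolution.fsResolvable-≈ (swap-A (swap-B o)) P₂≈Q₂)
    ... | inj₂ (inj₂ flipped) = inj₂ (Resolution.Flip.nfsFlipToFsResolvable o flipped)

    result : Occurrences F → FsResolvable F ⊎ NfsFlipToFsResolvable F
    result o with ⊆-or-outside P₁ Q₁ | ⊆-or-outside P₂ Q₁ | ⊆-or-outside Q₁ P₁
                | ⊆-or-outside Q₂ P₁ | ⊆-or-outside Q₁ P₂ | ⊆-or-outside Q₂ P₂
      where open Residues o
    ... | inj₁ P₁⊆Q₁ | _ | _ | _ | _ | _ = result-⊆ o P₁⊆Q₁
    ... | inj₂ _ | inj₁ P₂⊆Q₁ | _ | _ | _ | _ = result-⊆ (swap-A o) P₂⊆Q₁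
    ... | inj₂ _ | inj₂ _ | inj₁ Q₁⊆P₁ | _ | _ | _ = result-⊆ (mirror o) Q₁⊆P₁
    ... | inj₂ _ | inj₂ _ | inj₂ _ | inj₁ Q₂⊆P₁ | _ | _ = result-⊆ (swap-A (mirror o)) Q₂⊆P₁
    ... | inj₂ _ | inj₂ _ | inj₂ _ | inj₂ _ | inj₁ Q₁⊆P₂ | _ = result-⊆ (mirror (swap-A o)) Q₁⊆P₂
    ... | inj₂ _ | inj₂ _ | inj₂ _ | inj₂ _ | inj₂ _ | inj₁ Q₂⊆P₂ =
      result-⊆ (swap-A (mirror (swap-A o))) Q₂⊆P₂
    ... | inj₂ P₁⊈Q₁ | inj₂ P₂⊈Q₁ | inj₂ Q₁⊈P₁ | inj₂ Q₂⊈P₁ | inj₂ Q₁⊈P₂ | inj₂ Q₂⊈P₂ =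
      inj₁ (Resolution.fsResolvable-fsPair o
        (residues-fsPair (residueConditions o) P₁⊈Q₁ P₂⊈Q₁ Q₁⊈P₁ Q₂⊈P₁ Q₁⊈P₂ Q₂⊈P₂))

lemma24 : (F : ClauseSet) → IsClauseSet F → ¬ Satisfiable F → Hitting F
    → (v : ℤ) → 0ℤ < v → InVar v F → ldeg F v ≡ 2 → ldeg F (- v) ≡ 2
    → FsResolvable F ⊎ NfsFlipToFsResolvable F
lemma24 F isClauseSet unsat hitting v _ _ deg-v deg-¬v = result isClauseSet hitting unsat record
  { p = v ; p̄ = - v ; p̄≡-p = refl ; p≡-p̄ = sym (neg-involutive v)
  ; occ-p = exactlyTwo isClauseSet deg-v ; occ-p̄ = exactlyTwo isClauseSet deg-¬v }
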